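{- Let $(\vec U,\le,{}^*,\vee,\wedge)$ be a universe of separations containing a separation system $(\vec S,\le,{}^*)$ with induced ordering and involution. Let $\mathcal F\subseteq 2^{\vec S}$ be a set of stars and $(T,\alpha)$ an irredundant $S$-tree over $\mathcal F$. Let $x$ be a leaf of $T$, let $\vec e$ be its edge at $x$ oriented away from $x$, and assume $\vec r=\alpha(\vec e)$ is nontrivial and nondegenerate and that $\alpha(\vec e')\ne\vec r$ for every other $\vec e'\in\vec E(T)$. Let $\vec s_0\in\vec S$ be $\mathcal F$-linked to $\vec r$, and let $\alpha'=f^{\vec r}_{\vec s_0}\circ\alpha$. Then $(T,\alpha')$ is an $S$-tree over $\mathcal F\cup\{\{\overleftarrow{s_0}\}\}$ in which $\{\overleftarrow{s_0}\}$ is associated with $x$ but with no other leaf of $T$.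
   Context: A separation system is a poset $\vec S$ with an order-reversing involution ${}^*$; if an element is written $\vec s$, its image is $\overleftarrow s$; a separation is $s=\{\vec s,\overleftarrow s\}$, degenerate if $\vec s=\overleftarrow s$; $S$ is the set of separations. A universe is a separation system in which any two elements have a supremum $\vee$ and infimum $\wedge$. $\vec r$ is trivial in $\vec S$ if some $s\in S$ has $\vec r<\vec s$ and $\vec r<\overleftarrow s$. A star is a nonempty $\sigma\subseteq\vec S$ with $\vec r\le\overleftarrow s$ for all distinct $\vec r,\vec s\in\sigma$. An $S$-tree $(T,\alpha)$ is a tree $T$ with at least one edge and $\alpha:\vec E(T)\to\vec S$ ($\vec E(T)$ the set of ordered pairs $(x,y)$ with $xy\in E(T)$) with $\alpha(y,x)=\alpha(x,y)^*$; it is over $\mathcal F$ if $\alpha(\{(y,t):yt\in E(T)\})\in\mathcal F$ for every node $t$ (this set is associated with $t$); irredundant if no node $t$ has distinct neighbours $t',t''$ with $\alpha(t',t)=\alpha(t'',t)$. For nontrivial nondegenerate $\vec r$ and $\vec s_0\in\vec S$ with $\vec r\le\vec s_0$: $\vec S_{\ge\vec r}$ is the set of all orientations of those $s\in S$ having an orientation $\vec s\ge\vec r$; the shifting map $f^{\vec r}_{\vec s_0}:\vec S_{\ge\vec r}\to\vec U$ is given by $f(\vec s)=\vec s\vee\vec s_0$ and $f(\overleftarrow s)=(\vec s\vee\vec s_0)^*$ for each $\vec s\ge\vec r$ in $\vec S_{\ge\vec r}\setminus\{\overleftarrow r\}$. $\vec s_0$ is linked to $\vec r$ if $\vec s_0\ge\vec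 r$ and $\vec s\vee\vec s_0\in\vec S$ for every $\vec s\in\vec S$ with $\vec s\ge\vec r$, $\vec s\ne\overleftarrow r$. $\vec s_0$ is $\mathcal F$-linked to $\vec r$ if it is linked to $\vec r$ and for every star $\sigma\in\mathcal F$ with $\sigma\subseteq\vec S_{\ge\vec r}\setminus\{\overleftarrow r\}$ having an element $\ge\vec r$, the image $f^{\vec r}_{\vec s_0}(\sigma)$ lies in $\mathcal F$. -}

module Defs where

open import Level using (0ℓ)
open import Data.Nat using (ℕ; suc)
open import Data.Fin using (Fin; zero; suc; inject₁; fromℕ)
open import Data.Product using (Σ; ∃; ∃₂; _×_; _,_)
open import Data.Sum using (_⊎_)
open import Relation.Nullary using (¬_)
open import Relation.Binary.PropositionalEquality using (_≡_; _≢_)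
open import Relation.Binary.Core using (Rel)
open import Algebra.Core using (Op₂)
open import Relation.Binary.Lattice.Structures using (IsLattice)
open import Function.Definitions using (Injective)

record Universe : Set₁ where
  infix 4 _≤_
  infixl 6 _∨_ _∧_
  infix 8 _*
  field
    U          : Set
    _≤_        : Rel U 0ℓ
    _∨_        : Op₂ U
    _∧_        : Op₂ U
    isLattice  : IsLattice _≡_ _≤_ _∨_ _∧_
    _*         : U → U
    involutive : ∀ x → (x *) * ≡ x
    reversing  : ∀ {x y} → x ≤ y → y * ≤ x *

Subset : Universe → Set₁
Subset 𝒰 = Universe.U 𝒰 → Set

SetEq : (𝒰 : Universe) → Subset 𝒰 → Subset 𝒰 → Set
SetEq 𝒰 A B = ∀ u → (A u → B u) × (B u → A u)

Singleton : (𝒰 : Universe) → Universe.U 𝒰 → Subset 𝒰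
Singleton 𝒰 a = λ u → u ≡ a

Insert : (𝒰 : Universe) → (Subset 𝒰 → Set) → Subset 𝒰 → (Subset 𝒰 → Set)
Insert 𝒰 F A σ = F σ ⊎ SetEq 𝒰 σ A

RespectsSetEq : (𝒰 : Universe) → (Subset 𝒰 → Set) → Set₁
RespectsSetEq 𝒰 F = ∀ (A B : Subset 𝒰) → SetEq 𝒰 A B → F A → F B

module _ (𝒰 : Universe) where
  open Universe 𝒰

  _<_ : U → U → Set
  x < y = x ≤ y × x ≢ y

  Degenerate : U → Set
  Degenerate r = r ≡ r *

  Trivial : (S : U → Set) → U → Set
  Trivial S r = ∃ λ s → S s × r < s × r < (s *)

  IsStar : Subset 𝒰 → Set
  IsStar σ = (∃ λ a → σ a) × (∀ r s → σ r → σ s → r ≢ s → r ≤ s *)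

  SetOfStars : (S : U → Set) → (Subset 𝒰 → Set) → Set₁
  SetOfStars S F = ∀ σ → F σ → IsStar σ × (∀ a → σ a → S a)

  S≥ : (S : U → Set) → U → U → Set
  S≥ S r a = S a × (r ≤ a ⊎ r ≤ a *)

  -- Graph of the shifting map f^r_{s0} : S_{≥r} → U:
  --   f(s) = s ∨ s0 and f(s*) = (s ∨ s0)* for s ≥ r in S_{≥r} \ {r*}.
  -- ShiftRel S r s0 a b  means  a ∈ S_{≥r}  and  b = f(a).
  ShiftRel : (S : U → Set) → U → U → U → U → Set
  ShiftRel S r s0 a b =
    S≥ S r a ×
    ((r ≤ a × a ≢ r * × b ≡ a ∨ s0) ⊎ (r ≤ a * × a * ≢ r * × b ≡ (a * ∨ s0) *))

  ShiftImage : (S : U → Set) → U → U → Subset 𝒰 → Subset 𝒰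
  ShiftImage S r s0 σ b = ∃ λ a → σ a × ShiftRel S r s0 a b

  Linked : (S : U → Set) → U → U → Set
  Linked S r s0 = r ≤ s0 × (∀ s → S s → r ≤ s → s ≢ r * → S (s ∨ s0))

  FLinked : (S : U → Set) → (Subset 𝒰 → Set) → U → U → Set₁
  FLinked S F r s0 =
    Linked S r s0 ×
    (∀ σ → F σ → IsStar σ →
       (∀ a → σ a → S≥ S r a × a ≢ r *) →
       (∃ λ a → σ a × r ≤ a) →
       F (ShiftImage S r s0 σ))

data Walk {n : ℕ} (E : Fin n → Fin n → Set) : Fin n → Fin n → Set where
  []  : ∀ {x} → Walk E x x
  _∷_ : ∀ {x y z} → E x y → Walk E y z → Walk E x z

record Cycle {n : ℕ} (E : Fin n → Fin n → Set) : Set where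
  field
    k           : ℕ
    c           : Fin (suc (suc (suc k))) → Fin n
    injective   : Injective _≡_ _≡_ c
    consecutive : ∀ (i : Fin (suc (suc k))) → E (c (inject₁ i)) (c (suc i))
    closing     : E (c (fromℕ (suc (suc k)))) (c zero)

record Tree (n : ℕ) : Set₁ where
  field
    E         : Fin n → Fin n → Set
    E-sym     : ∀ {x y} → E x y → E y x
    E-irrefl  : ∀ {x} → ¬ E x x
    hasEdge   : ∃₂ λ x y → E x y
    connected : ∀ x y → Walk E x y
    acyclic   : ¬ Cycle E

IsLeaf : {n : ℕ} → Tree n → Fin n → Set
IsLeaf T x = ∃ λ y → E x y × (∀ z → E x z → z ≡ y)
  where open Tree T

-- S-trees; α is given on all ordered pairs of nodes but only its values on
-- oriented edges (x , y) with E x y matter.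

module _ (𝒰 : Universe) where
  open Universe 𝒰

  IsSTree : (S : U → Set) → {n : ℕ} → Tree n → (Fin n → Fin n → U) → Set
  IsSTree S T α = ∀ x y → E x y → S (α x y) × α y x ≡ α x y *
    where open Tree T

  Assoc : {n : ℕ} → Tree n → (Fin n → Fin n → U) → Fin n → Subset 𝒰
  Assoc T α t u = ∃ λ y → E y t × u ≡ α y t
    where open Tree T

  Over : (Subset 𝒰 → Set) → {n : ℕ} → Tree n → (Fin n → Fin n → U) → Set
  Over F T α = ∀ t → F (Assoc T α t)

  Irredundant : {n : ℕ} → Tree n → (Fin n → Fin n → U) → Set
  Irredundant T α = ∀ t t′ t″ → E t′ t → E t″ t → t′ ≢ t″ → α t′ t ≢ α t″ t
    where open Tree T

module Submission where

-- Let r = α(x,y) be the label of the leaf edge at x.  The proof has two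
-- independent ingredients.
--   * Order theory of the shifting map f = f^r_{s₀}: because r is
--     nontrivial, a separation of S has at most one orientation above r
--     (up to r and r*), so f is a well-defined function on S_{≥r}; it maps
--     into S (s₀ is linked to r), commutes with *, sends r* to s₀*, and
--     sends no a ≥ r other than r* to s₀* (r is nontrivial and nondegenerate).
--   * Geometry of the tree: in an irredundant S-tree over stars, α increases
--     along non-backtracking walks; since x is a leaf, every node t ≠ x is
--     the end of such a walk starting with the edge xy, so the edge into t
--     from its "parent" carries a label ≥ r.  Hence every label lies in
--     S_{≥r}, and the star at every t ≠ x has an element ≥ r.
-- The theorem follows: α′ = f ∘ α is an S-tree; the star at x becomes
-- {s₀*}; the star at t ≠ x is the f-image of a star of F, which lies in F by
-- F-linkedness; and at a leaf t ≠ x the single label f(α(p,t)) ≠ s₀*.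

open import Defs
open import Data.Nat using (ℕ)
open import Data.Fin using (Fin)
open import Data.Fin.Properties using (_≟_)
open import Data.Product using (_×_; _,_; proj₁; proj₂; ∃)
open import Data.Sum using (inj₁; inj₂)
open import Data.Empty using (⊥; ⊥-elim)
open import Relation.Nullary using (¬_; yes; no)
open import Relation.Binary.PropositionalEquality
  using (_≡_; _≢_; refl; sym; trans; cong; cong₂; subst; module ≡-Reasoning)
open import Relation.Binary.Lattice.Structures using (IsLattice)

module Order (𝒰 : Universe) where
  open Universe 𝒰
  open IsLattice isLattice using (y≤x∨y; ∨-least; antisym) renaming (refl to ≤-refl)

  ∨-of-≤ : ∀ {a b} → a ≤ b → a ∨ b ≡ b
  ∨-of-≤ {a} {b} a≤b = antisym (∨-least a≤b ≤-refl) (y≤x∨y a b)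

  *-injective : ∀ {a b} → a * ≡ b * → a ≡ b
  *-injective {a} {b} eq = trans (sym (involutive a)) (trans (cong _* eq) (involutive b))

  *-swap : ∀ {a b} → a ≡ b * → b ≡ a *
  *-swap {b = b} eq = trans (sym (involutive b)) (cong _* (sym eq))

  ≤*-swap : ∀ {a b} → a ≤ b * → b ≤ a *
  ≤*-swap {a} {b} le = subst (_≤ a *) (involutive b) (reversing le)

-- A nontrivial r lies below both orientations of a separation a ∈ S only if
-- a is r or r*; this is what makes the shifting map single-valued.
module Nontrivial (𝒰 : Universe) (S : Universe.U 𝒰 → Set) (r : Universe.U 𝒰)
  (nontrivial : ¬ Trivial 𝒰 S r) where
  open Universe 𝒰
  open Order 𝒰

  below-both : ∀ {a} → S a → r ≤ a → r ≤ a * → a ≢ r * → a * ≢ r * → ⊥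
  below-both {a} Sa r≤a r≤a* a≢r* a*≢r* =
    nontrivial (a , Sa , (r≤a , λ r≡a → a*≢r* (cong _* (sym r≡a)))
                       , (r≤a* , λ r≡a* → a≢r* (*-swap r≡a*)))

module Shift (𝒰 : Universe) (S : Universe.U 𝒰 → Set)
  (S-* : ∀ {s} → S s → S (Universe._* 𝒰 s))
  (r : Universe.U 𝒰) (nontrivial : ¬ Trivial 𝒰 S r) (nondegenerate : ¬ Degenerate 𝒰 r)
  (s₀ : Universe.U 𝒰) (S-s₀ : S s₀) (linked : Linked 𝒰 S r s₀) where
  open Universe 𝒰
  open IsLattice isLattice using (x≤x∨y; y≤x∨y) renaming (refl to ≤-refl; trans to ≤-trans; antisym to ≤-antisym)
  open Order 𝒰
  open Nontrivial 𝒰 S r nontrivial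

  f : U → U → Set
  f = ShiftRel 𝒰 S r s₀

  r≤s₀ : r ≤ s₀
  r≤s₀ = proj₁ linked

  -- f maps into S: this is exactly what linkedness provides.
  f-into-S : ∀ {a b} → f a b → S b
  f-into-S ((Sa , _) , inj₁ (r≤a , a≢r* , b≡)) =
    subst S (sym b≡) (proj₂ linked _ Sa r≤a a≢r*)
  f-into-S ((Sa , _) , inj₂ (r≤a* , a*≢r* , b≡)) =
    subst S (sym b≡) (S-* (proj₂ linked _ (S-* Sa) r≤a* a*≢r*))

  f-functional : ∀ {a b c} → f a b → f a c → b ≡ c
  f-functional (_ , inj₁ (_ , _ , b≡)) (_ , inj₁ (_ , _ , c≡)) = trans b≡ (sym c≡)
  f-functional (_ , inj₂ (_ , _ , b≡)) (_ , inj₂ (_ , _ , c≡)) = trans b≡ (sym c≡)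
  f-functional ((Sa , _) , inj₁ (r≤a , a≢r* , _)) (_ , inj₂ (r≤a* , a*≢r* , _)) =
    ⊥-elim (below-both Sa r≤a r≤a* a≢r* a*≢r*)
  f-functional ((Sa , _) , inj₂ (r≤a* , a*≢r* , _)) (_ , inj₁ (r≤a , a≢r* , _)) =
    ⊥-elim (below-both Sa r≤a r≤a* a≢r* a*≢r*)

  f-commutes-* : ∀ {a b c} → S a → f a b → f (a *) c → c ≡ b *
  f-commutes-* Sa (_ , inj₁ (r≤a , a≢r* , _)) (_ , inj₁ (r≤a* , a*≢r* , _)) =
    ⊥-elim (below-both Sa r≤a r≤a* a≢r* a*≢r*)
  f-commutes-* {a} _ (_ , inj₁ (_ , _ , b≡)) (_ , inj₂ (_ , _ , c≡)) =
    trans c≡ (cong _* (trans (cong (_∨ s₀) (involutive a)) (sym b≡)))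
  f-commutes-* _ (_ , inj₂ (_ , _ , b≡)) (_ , inj₁ (_ , _ , c≡)) =
    trans c≡ (*-swap b≡)
  f-commutes-* {a} Sa (_ , inj₂ (r≤a* , a*≢r* , _)) (_ , inj₂ (r≤a** , a**≢r* , _)) =
    ⊥-elim (below-both Sa (subst (r ≤_) (involutive a) r≤a**) r≤a*
                          (λ a≡r* → a**≢r* (trans (involutive a) a≡r*)) a*≢r*)

  f-r* : ∀ {b} → f (r *) b → b ≡ s₀ *
  f-r* (_ , inj₁ (_ , r*≢r* , _)) = ⊥-elim (r*≢r* refl)
  f-r* (_ , inj₂ (_ , _ , b≡)) = begin
    _                ≡⟨ b≡ ⟩
    (r * * ∨ s₀) *   ≡⟨ cong (λ q → (q ∨ s₀) *) (involutive r) ⟩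
    (r ∨ s₀) *       ≡⟨ cong _* (∨-of-≤ r≤s₀) ⟩
    s₀ *             ∎
    where open ≡-Reasoning

  f-avoids-s₀* : ∀ {a} → S a → r ≤ a → a ≢ r * → a ∨ s₀ ≢ s₀ *
  f-avoids-s₀* {a} Sa r≤a a≢r* a∨s₀≡s₀* = below-both S-s₀ r≤s₀ r≤s₀* s₀≢r* s₀*≢r*
    where
      s₀≤s₀* : s₀ ≤ s₀ *
      s₀≤s₀* = subst (s₀ ≤_) a∨s₀≡s₀* (y≤x∨y a s₀)

      r≤s₀* : r ≤ s₀ *
      r≤s₀* = ≤-trans r≤s₀ s₀≤s₀*

      -- s₀ = r* would give r ≤ r* ≤ r, so r would be degenerate.
      s₀≢r* : s₀ ≢ r *
      s₀≢r* s₀≡r* = nondegenerate (≤-antisym (subst (r ≤_) s₀≡r* r≤s₀) r*≤r)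
        where
          r*≤r : r * ≤ r
          r*≤r = subst (r * ≤_) (involutive r) (subst (λ q → q ≤ q *) s₀≡r* s₀≤s₀*)

      -- s₀ = r would give a ≤ r*, so r lies below both orientations of a;
      -- a = r is then excluded because it would make a ∨ s₀ = r equal to r*.
      s₀*≢r* : s₀ * ≢ r *
      s₀*≢r* s₀*≡r* = below-both Sa r≤a (≤*-swap a≤r*) a≢r* a*≢r*
        where
          s₀≡r : s₀ ≡ r
          s₀≡r = *-injective s₀*≡r*

          a≤r* : a ≤ r *
          a≤r* = subst (a ≤_) (trans a∨s₀≡s₀* s₀*≡r*) (x≤x∨y a s₀)

          a*≢r* : a * ≢ r *
          a*≢r* a*≡r* = nondegenerate (begin
            r          ≡⟨ sym (∨-of-≤ ≤-refl) ⟩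
            r ∨ r      ≡⟨ cong₂ _∨_ (sym (*-injective a*≡r*)) (sym s₀≡r) ⟩
            a ∨ s₀     ≡⟨ a∨s₀≡s₀* ⟩
            s₀ *       ≡⟨ s₀*≡r* ⟩
            r *        ∎)
            where open ≡-Reasoning

-- Non-backtracking walks in a tree that start with a fixed edge xy.
-- Outward u p: there is a non-backtracking walk x, y, …, p, u.
module Walks {n : ℕ} (T : Tree n) (x y : Fin n) (xy : Tree.E T x y) where
  open Tree T

  data Outward : Fin n → Fin n → Set where
    start  : Outward y x
    extend : ∀ {u p v} → Outward u p → E u v → v ≢ p → Outward v u

  last-edge : ∀ {u p} → Outward u p → E p u
  last-edge start          = xy
  last-edge (extend _ e _) = e

-- Along any walk from x we maintain the non-backtracking
-- walk it reduces to, dropping the last edge whenever the walk steps back.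
module Reach {n : ℕ} (T : Tree n) (x y : Fin n) (xy : Tree.E T x y)
  (leaf : ∀ z → Tree.E T x z → z ≡ y) where
  open Tree T
  open Walks T x y xy

  data Reduced : Fin n → Set where
    at-x : Reduced x
    via  : ∀ {u p} → Outward u p → Reduced u

  retract : ∀ {u p} → Outward u p → Reduced p
  retract start           = at-x
  retract (extend pth _ _) = via pth

  follow : ∀ {w u} → Reduced w → Walk E w u → Reduced u
  follow red [] = red
  follow at-x (e ∷ walk) = follow (subst Reduced (sym (leaf _ e)) (via start)) walk
  follow (via {p = p} pth) (_∷_ {y = v} e walk) with v ≟ p
  ... | yes v≡p = follow (subst Reduced (sym v≡p) (retract pth)) walk
  ... | no  v≢p = follow (via (extend pth e v≢p)) walk

  parent : ∀ t → t ≢ x → ∃ λ p → Outward t p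
  parent t t≢x with follow at-x (connected x t)
  ... | at-x    = ⊥-elim (t≢x refl)
  ... | via pth = _ , pth

module Monotone (𝒰 : Universe) {n : ℕ} (T : Tree n) (α : Fin n → Fin n → Universe.U 𝒰)
  (α-* : ∀ u v → Tree.E T u v → α v u ≡ Universe._* 𝒰 (α u v))
  (stars : ∀ t → IsStar 𝒰 (Assoc 𝒰 T α t)) (irredundant : Irredundant 𝒰 T α)
  (x y : Fin n) (xy : Tree.E T x y) where
  open Universe 𝒰
  open IsLattice isLattice using () renaming (refl to ≤-refl; trans to ≤-trans)
  open Tree T
  open Walks T x y xy

  -- Two distinct edges p u, v u into u are distinct elements of the star at
  -- u, so α(p,u) ≤ α(v,u)* = α(u,v).
  turn-increases : ∀ {p u v} → E p u → E u v → v ≢ p → α p u ≤ α u v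
  turn-increases {p} {u} {v} pu uv v≢p =
    subst (α p u ≤_) α-vu* (proj₂ (stars u) _ _ (p , pu , refl) (v , E-sym uv , refl)
                                   (irredundant u p v pu (E-sym uv) (λ p≡v → v≢p (sym p≡v))))
    where
      α-vu* : α v u * ≡ α u v
      α-vu* = trans (cong _* (α-* u v uv)) (involutive (α u v))

  outward-increases : ∀ {u p} → Outward u p → α x y ≤ α p u
  outward-increases start = ≤-refl
  outward-increases (extend pth uv v≢p) =
    ≤-trans (outward-increases pth) (turn-increases (last-edge pth) uv v≢p)

module ShiftAtLeaf (𝒰 : Universe) (S : Universe.U 𝒰 → Set)
  (S-* : ∀ {s} → S s → S (Universe._* 𝒰 s))
  (F : Subset 𝒰 → Set) (F-resp : RespectsSetEq 𝒰 F) (F-stars : SetOfStars 𝒰 S F)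
  {n : ℕ} (T : Tree n) (α : Fin n → Fin n → Universe.U 𝒰)
  (sTree : IsSTree 𝒰 S T α) (over : Over 𝒰 F T α) (irredundant : Irredundant 𝒰 T α)
  (x y : Fin n) (xy : Tree.E T x y) (leaf : ∀ z → Tree.E T x z → z ≡ y)
  (nontrivial : ¬ Trivial 𝒰 S (α x y)) (nondegenerate : ¬ Degenerate 𝒰 (α x y))
  (unique : ∀ u v → Tree.E T u v → ¬ (u ≡ x × v ≡ y) → α u v ≢ α x y)
  (s₀ : Universe.U 𝒰) (S-s₀ : S s₀) (F-linked : FLinked 𝒰 S F (α x y) s₀) where
  open Universe 𝒰
  open IsLattice isLattice using () renaming (refl to ≤-refl)
  open Tree T
  open Walks T x y xy
  open Reach T x y xy leaf
  open Monotone 𝒰 T α (λ u v e → proj₂ (sTree u v e)) (λ t → proj₁ (F-stars _ (over t)))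
                irredundant x y xy
  open Nontrivial 𝒰 S (α x y) nontrivial
  open Shift 𝒰 S S-* (α x y) nontrivial nondegenerate s₀ S-s₀ (proj₁ F-linked)

  r : U
  r = α x y

  -- Every label lies in S_{≥r}: edges out of a node t point away from x
  -- (label ≥ r) unless they lead back to t's parent (label ≤ r*).
  labels-in-S≥r : ∀ u v → E u v → S≥ 𝒰 S r (α u v)
  labels-in-S≥r u v uv with u ≟ x
  ... | yes refl =
    subst (λ w → S≥ 𝒰 S r (α x w)) (sym (leaf v uv)) (proj₁ (sTree x y xy) , inj₁ ≤-refl)
  ... | no u≢x with parent u u≢x
  ...   | p , pth with v ≟ p
  ...     | yes refl = proj₁ (sTree u v uv)
                     , inj₂ (subst (r ≤_) (proj₂ (sTree u v uv)) (outward-increases pth))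
  ...     | no v≢p = proj₁ (sTree u v uv) , inj₁ (outward-increases (extend pth uv v≢p))

  -- Only the edge (y , x) carries the label r*.
  label-into-t≢r* : ∀ t w → t ≢ x → E w t → α w t ≢ r *
  label-into-t≢r* t w t≢x wt α-wt≡r* =
    unique t w (E-sym wt) (λ t≡x×w≡y → t≢x (proj₁ t≡x×w≡y))
      (trans (proj₂ (sTree w t wt)) (trans (cong _* α-wt≡r*) (involutive r)))

  module Shifted (α′ : Fin n → Fin n → U) (shifted : ∀ u v → E u v → f (α u v) (α′ u v)) where

    is-sTree : IsSTree 𝒰 S T α′
    is-sTree u v uv =
      f-into-S (shifted u v uv) ,
      f-commutes-* (proj₁ (sTree u v uv)) (shifted u v uv)
        (subst (λ a → f a (α′ v u)) (proj₂ (sTree u v uv)) (shifted v u (E-sym uv)))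

    assoc-x : SetEq 𝒰 (Assoc 𝒰 T α′ x) (Singleton 𝒰 (s₀ *))
    assoc-x b = (λ { (w , wx , b≡) → trans b≡ (subst (λ q → α′ q x ≡ s₀ *) (sym (leaf w (E-sym wx))) α′-yx) })
              , λ b≡ → y , E-sym xy , trans b≡ (sym α′-yx)
      where
        α′-yx : α′ y x ≡ s₀ *
        α′-yx = f-r* (subst (λ a → f a (α′ y x)) (proj₂ (sTree x y xy)) (shifted y x (E-sym xy)))

    -- At t ≠ x the star of α satisfies the hypotheses of F-linkedness, and
    -- its image under f is the star of α′ at t.
    assoc-in-F : ∀ t → t ≢ x → F (Assoc 𝒰 T α′ t)
    assoc-in-F t t≢x =
      F-resp _ _ image-is-assoc
        (proj₂ F-linked σ (over t) (proj₁ (F-stars σ (over t))) σ-in-S≥r has-element-≥r)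
      where
        σ = Assoc 𝒰 T α t

        σ-in-S≥r : ∀ a → σ a → S≥ 𝒰 S r a × a ≢ r *
        σ-in-S≥r a (w , wt , a≡) =
          subst (S≥ 𝒰 S r) (sym a≡) (labels-in-S≥r w t wt) ,
          λ a≡r* → label-into-t≢r* t w t≢x wt (trans (sym a≡) a≡r*)

        has-element-≥r : ∃ λ a → σ a × r ≤ a
        has-element-≥r with parent t t≢x
        ... | p , pth = α p t , (p , last-edge pth , refl) , outward-increases pth

        image-is-assoc : SetEq 𝒰 (ShiftImage 𝒰 S r s₀ σ) (Assoc 𝒰 T α′ t)
        image-is-assoc b =
          (λ { (a , (w , wt , a≡) , fab) →
                 w , wt , f-functional (subst (λ a → f a b) a≡ fab) (shifted w t wt) })
          , λ { (w , wt , b≡) → α w t , (w , wt , refl) , subst (f (α w t)) (sym b≡) (shifted w t wt) }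

    is-over : Over 𝒰 (Insert 𝒰 F (Singleton 𝒰 (s₀ *))) T α′
    is-over t with t ≟ x
    ... | yes refl = inj₂ assoc-x
    ... | no t≢x   = inj₁ (assoc-in-F t t≢x)

    -- The star at t ≠ x contains f(α(p,t)) for the parent p of t, which is
    -- not s₀*; so it is not {s₀*} (whether or not t is a leaf).
    assoc-not-s₀* : ∀ t → t ≢ x → ¬ SetEq 𝒰 (Assoc 𝒰 T α′ t) (Singleton 𝒰 (s₀ *))
    assoc-not-s₀* t t≢x assoc≡ with parent t t≢x
    ... | p , pth with shifted p t (last-edge pth)
    ...   | (S-a , _) , inj₁ (_ , _ , b≡) =
            f-avoids-s₀* S-a (outward-increases pth) (label-into-t≢r* t p t≢x (last-edge pth))
              (trans (sym b≡) (proj₁ (assoc≡ (α′ p t)) (p , last-edge pth , refl)))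
    ...   | (S-a , _) , inj₂ (r≤a* , a*≢r* , _) =
            below-both S-a (outward-increases pth) r≤a*
              (label-into-t≢r* t p t≢x (last-edge pth)) a*≢r*

lemma4p3 : (𝒰 : Universe) → let open Universe 𝒰 in
    (S : U → Set) → (∀ {s} → S s → S (s *)) →
    (F : Subset 𝒰 → Set) → RespectsSetEq 𝒰 F → SetOfStars 𝒰 S F →
    {n : ℕ} (T : Tree n) → let open Tree T in
    (α : Fin n → Fin n → U) → IsSTree 𝒰 S T α → Over 𝒰 F T α → Irredundant 𝒰 T α →
    (x y : Fin n) → E x y → (∀ z → E x z → z ≡ y) →
    ¬ Trivial 𝒰 S (α x y) → ¬ Degenerate 𝒰 (α x y) →
    (∀ u v → E u v → ¬ (u ≡ x × v ≡ y) → α u v ≢ α x y) →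
    (s₀ : U) → S s₀ → FLinked 𝒰 S F (α x y) s₀ →
    (∀ u v → E u v → S≥ 𝒰 S (α x y) (α u v)) ×
    (∀ (α′ : Fin n → Fin n → U) →
      (∀ u v → E u v → ShiftRel 𝒰 S (α x y) s₀ (α u v) (α′ u v)) →
      IsSTree 𝒰 S T α′ ×
      Over 𝒰 (Insert 𝒰 F (Singleton 𝒰 (s₀ *))) T α′ ×
      SetEq 𝒰 (Assoc 𝒰 T α′ x) (Singleton 𝒰 (s₀ *)) ×
      (∀ z → IsLeaf T z → z ≢ x → ¬ SetEq 𝒰 (Assoc 𝒰 T α′ z) (Singleton 𝒰 (s₀ *))))
lemma4p3 𝒰 S S-* F F-resp F-stars T α sTree over irredundant x y xy leaf
         nontrivial nondegenerate unique s₀ S-s₀ F-linked =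
  L.labels-in-S≥r ,
  λ α′ shifted → let open L.Shifted α′ shifted in
    is-sTree , is-over , assoc-x , λ z _ z≢x → assoc-not-s₀* z z≢x
  where
    module L = ShiftAtLeaf 𝒰 S S-* F F-resp F-stars T α sTree over irredundant x y xy leaf
                        nontrivial nondegenerate unique s₀ S-s₀ F-linked
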